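{- For every integer $u\ge 4$, $$3\,C_{24}^{(3\cdot 2^u)}\equiv \mathbf{C}_0+2^{u-2}\mathbf{C}_1\pmod{2^u}$$ (entrywise), where $\mathbf{C}_0=\mathrm{Circ}(2,0,0,0,0,0,0,0,-1,0,0,0,0,0,0,0,-1,0,0,0,0,0,0,0)$ and $\mathbf{C}_1=\mathrm{Circ}(2,0,2,0,1,0,2,0,1,0,0,0,2,0,0,0,1,0,2,0,1,0,2,0)$.
   Context: For positive integers $k$ and non-negative integers $i$, $C_k^{(i)}$ is the $k\times k$ integer matrix with $(C_k^{(i)})_{r,s}=\sum_{\alpha\in\mathbb{Z}}\binom{i}{\alpha k+r-s}$ for $r,s\in\{1,\dots,k\}$, with $\binom{a}{b}=0$ if $b<0$ or $b>a$. For a $k$-tuple $(u_0,\dots,u_{k-1})$, $\mathrm{Circ}(u_0,\dots,u_{k-1})$ is the $k\times k$ circulant matrix whose $(r,s)$ entry is $u_{(s-r \bmod k)}$, $r,s\in\{1,\dots,k\}$. -}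

module Defs where

open import Data.Nat as ℕ using (ℕ; zero; suc; NonZero)
open import Data.Nat.DivMod using (_%_)
open import Data.Nat.Combinatorics using (_C_)
open import Data.Fin using (Fin; toℕ; fromℕ<)
open import Data.Nat.DivMod using (m%n<n)
open import Data.Integer as ℤ using (ℤ; +_; -_)
open import Data.Integer.Divisibility using (_∣_)
open import Data.Vec using (Vec; lookup; []; _∷_)
open import Data.Bool using (if_then_else_)
open import Relation.Nullary.Decidable using (⌊_⌋)

-- k × k integer matrices, indices 0-based (Fin k) instead of 1..k;
-- all definitions depend only on differences of indices, so this is harmless.
Mat : ℕ → Set
Mat k = Fin k → Fin k → ℤ

sumTo : ℕ → (ℕ → ℕ) → ℕ
sumTo zero    f = f 0
sumTo (suc n) f = sumTo n f ℕ.+ f (suc n)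

-- (C_k^{(i)})_{r,s} = Σ_{α∈ℤ} binom(i, αk + r − s).
-- The nonzero terms are exactly j = αk + r − s with 0 ≤ j ≤ i, i.e. the j ∈ [0,i]
-- with j ≡ r − s (mod k), i.e. (j + s) mod k = r (for r, s ∈ [0,k)); each such j
-- corresponds to a unique α.
Cmat : (k : ℕ) .{{_ : NonZero k}} → ℕ → Mat k
Cmat k i r s =
  + sumTo i (λ j → if ⌊ (j ℕ.+ toℕ s) % k ℕ.≟ toℕ r ⌋ then i C j else 0)

Circ : (k : ℕ) .{{_ : NonZero k}} → Vec ℤ k → Mat k
Circ k u r s = lookup u (fromℕ< (m%n<n (toℕ s ℕ.+ (k ℕ.∸ toℕ r)) k))

_≡ₘ_[mod_] : {k : ℕ} → Mat k → Mat k → ℤ → Set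
A ≡ₘ B [mod m ] = ∀ r s → m ∣ (A r s ℤ.- B r s)

_+ₘ_ : {k : ℕ} → Mat k → Mat k → Mat k
(A +ₘ B) r s = A r s ℤ.+ B r s

_·ₘ_ : {k : ℕ} → ℤ → Mat k → Mat k
(c ·ₘ A) r s = c ℤ.* A r s

C₀ : Mat 24
C₀ = Circ 24 (+ 2 ∷ + 0 ∷ + 0 ∷ + 0 ∷ + 0 ∷ + 0 ∷ + 0 ∷ + 0 ∷
              - + 1 ∷ + 0 ∷ + 0 ∷ + 0 ∷ + 0 ∷ + 0 ∷ + 0 ∷ + 0 ∷
              - + 1 ∷ + 0 ∷ + 0 ∷ + 0 ∷ + 0 ∷ + 0 ∷ + 0 ∷ + 0 ∷ [])

C₁ : Mat 24
C₁ = Circ 24 (+ 2 ∷ + 0 ∷ + 2 ∷ + 0 ∷ + 1 ∷ + 0 ∷ + 2 ∷ + 0 ∷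
              + 1 ∷ + 0 ∷ + 0 ∷ + 0 ∷ + 2 ∷ + 0 ∷ + 0 ∷ + 0 ∷
              + 1 ∷ + 0 ∷ + 2 ∷ + 0 ∷ + 1 ∷ + 0 ∷ + 2 ∷ + 0 ∷ [])

-- Index rows and columns by ℤ/24. Then C_24^{(i)} is the matrix of multiplication by
-- (1 + σ)^i in the group ring ℤ[ℤ/24] (σ the generator), and C₀, C₁ are the matrices of
-- multiplication by elements c₀, c₁, so the theorem is the congruence
-- 3 (1 + σ)^{3·2^u} ≡ c₀ + 2^{u-2} c₁ (mod 2^u) in a commutative ring.
-- For u = 4 it is a finite computation. If 3A ≡ Y (mod 2^u), then 9A² ≡ Y² (mod 2^{u+1}),
-- because (Y + 2^u E)² - Y² = 2^{u+1} Y E + 2^{2u} E². For Y = c₀ + 2^{u-2} c₁ the relations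
-- c₀² = 3c₀, c₀c₁ ≡ 3c₁ (mod 4) and c₁² ≡ 0 (mod 2), again finite computations, give
-- Y² ≡ 3 (c₀ + 2^{u-1} c₁) (mod 2^{u+1}) as soon as u ≥ 4; cancelling the odd factor 3
-- yields the case u + 1, with A² = (1 + σ)^{3·2^{u+1}}.
module Submission where

module CirculantBinomials where

  open import Data.Bool using (Bool; true; false; if_then_else_)
  open import Data.Fin as Fin using (Fin; toℕ; opposite; fromℕ<)
  import Data.Fin.Permutation as Perm
  import Data.Fin.Properties as Finₚ
  open import Data.Integer as ℤ using (ℤ; +_; -[1+_]; _+_; _-_; _*_; -_; _%ℕ_; _/ℕ_)
  import Data.Integer.Coprimality as ℤCoprime
  open import Data.Integer.DivMod using (n%ℕd<d; a≡a%ℕn+[a/ℕn]*n)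
  open import Data.Integer.Divisibility.Signed
    using (_∣_; _∣?_; divides; ∣⇒∣ᵤ; ∣ᵤ⇒∣; ∣-refl; ∣m∣n⇒∣m+n; ∣m∣n⇒∣m-n; ∣m+n∣n⇒∣m; ∣n⇒∣m*n; ∣m⇒∣m*n;
           *-monoʳ-∣; *-monoˡ-∣)
    renaming (∣-trans to ∣ℤ-trans)
  import Data.Integer.Properties as ℤₚ
  open import Algebra.Properties.AbelianGroup ℤₚ.+-0-abelianGroup using () renaming (∙-cancelˡ to +-cancelˡ)
  open import Algebra.Properties.Semiring.Sum ℤₚ.+-*-semiring
    using (sum; sum-syntax; sum-cong-≗; ∑-distrib-+; sum-init-last; sum-replicate-zero; *-distribˡ-sum;
           ∑-permute)
  open import Data.Integer.Tactic.RingSolver using (solve-∀)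
  open import Data.Nat as ℕ using (ℕ; zero; suc; _^_)
  open import Data.Nat.Combinatorics using (_C_; nCk+nC[k+1]≡[n+1]C[k+1]; k>n⇒nCk≡0)
  open import Data.Nat.Coprimality using (Coprime; coprime-divisor; 1-coprimeTo; gcd≡1⇒coprime)
  open import Data.Nat.DivMod using (m<n⇒m%n≡m)
  open import Data.Nat.Divisibility using (>⇒∤; ∣-trans) renaming (_∣_ to _∣ℕ_)
  import Data.Nat.Properties as ℕₚ
  import Data.Nat.Tactic.RingSolver as ℕ-Solver
  open import Data.Product using (_,_)
  open import Function using (_∘_; _⇔_; mk⇔; Equivalence)
  open import Relation.Binary.PropositionalEquality
  open import Relation.Nullary using (Dec; contradiction)
  open import Relation.Nullary.Decidable using (⌊_⌋; from-yes; isYes≗does; does-⇔; dec-true; dec-false)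
  open import Defs
  open ≡-Reasoning

  ⌊⌋-⇔ : ∀ {a b} {A : Set a} {B : Set b} → A ⇔ B → (a? : Dec A) (b? : Dec B) → ⌊ a? ⌋ ≡ ⌊ b? ⌋
  ⌊⌋-⇔ A⇔B a? b? = trans (isYes≗does a?) (trans (does-⇔ A⇔B a? b?) (sym (isYes≗does b?)))

  indicator : Bool → ℤ
  indicator b = if b then + 1 else + 0

  pos-if : ∀ b x → + (if b then x else 0) ≡ + x * indicator b
  pos-if true  x = sym (ℤₚ.*-identityʳ (+ x))
  pos-if false x = sym (ℤₚ.*-zeroʳ (+ x))

  pos-∸ : ∀ {m n} → n ℕ.≤ m → + (m ℕ.∸ n) ≡ + m - + n
  pos-∸ {m} {n} n≤m = trans (sym (ℤₚ.⊖-≥ n≤m)) (sym (ℤₚ.m-n≡m⊖n m n))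

  pos-2^-+ : ∀ a b → + (2 ^ (a ℕ.+ b)) ≡ + (2 ^ a) * + (2 ^ b)
  pos-2^-+ a b = trans (cong +_ (ℕₚ.^-distribˡ-+-* 2 a b)) (ℤₚ.pos-* (2 ^ a) (2 ^ b))

  m-n≡o⇒m≡n+o : ∀ {m n o} → m - n ≡ o → m ≡ n + o
  m-n≡o⇒m≡n+o {m} {n} refl = m≡n+[m-n] m n
    where m≡n+[m-n] : ∀ m n → m ≡ n + (m - n)
          m≡n+[m-n] = solve-∀

  coprime-* : ∀ {m n o} → Coprime m o → Coprime n o → Coprime (m ℕ.* n) o
  coprime-* {m} {n} m⊥o n⊥o {i} (i∣mn , i∣o) =
    m⊥o (coprime-divisor i⊥n (subst (i ∣ℕ_) (ℕₚ.*-comm m n) i∣mn) , i∣o)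
    where i⊥n : Coprime i n
          i⊥n (j∣i , j∣n) = n⊥o (j∣n , ∣-trans j∣i i∣o)

  ^-coprime : ∀ {m n} → Coprime m n → ∀ e → Coprime (m ^ e) n
  ^-coprime {n = n} m⊥n zero    = 1-coprimeTo n
  ^-coprime         m⊥n (suc e) = coprime-* m⊥n (^-coprime m⊥n e)

  2^e∣3x⇒2^e∣x : ∀ e x → + (2 ^ e) ∣ + 3 * x → + (2 ^ e) ∣ x
  2^e∣3x⇒2^e∣x e x 2^e∣3x = ∣ᵤ⇒∣ (ℤCoprime.coprime-divisor (+ (2 ^ e)) (+ 3) x
    (^-coprime (gcd≡1⇒coprime refl) e) (∣⇒∣ᵤ 2^e∣3x))

  ∑-∣ : ∀ {n x} (f : Fin n → ℤ) → (∀ i → x ∣ f i) → x ∣ sum f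
  ∑-∣ {zero}  f x∣f = divides (+ 0) refl
  ∑-∣ {suc n} f x∣f = ∣m∣n⇒∣m+n (x∣f Fin.zero) (∑-∣ (f ∘ Fin.suc) (x∣f ∘ Fin.suc))

  ∑-last : ∀ n (f : ℕ → ℤ) → ∑[ j < suc n ] f (toℕ j) ≡ ∑[ j < n ] f (toℕ j) + f n
  ∑-last n f = trans (sum-init-last {n} (f ∘ toℕ))
    (cong₂ _+_ (sum-cong-≗ {n} (cong f ∘ Finₚ.toℕ-inject₁)) (cong f (Finₚ.toℕ-fromℕ n)))

  sumTo-∑ : ∀ n g → + sumTo n g ≡ ∑[ j < suc n ] (+ g (toℕ j))
  sumTo-∑ zero    g = sym (ℤₚ.+-identityʳ (+ g 0))
  sumTo-∑ (suc n) g = begin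
    + (sumTo n g ℕ.+ g (suc n))                 ≡⟨ ℤₚ.pos-+ (sumTo n g) (g (suc n)) ⟩
    + sumTo n g + + g (suc n)                   ≡⟨ cong (_+ + g (suc n)) (sumTo-∑ n g) ⟩
    ∑[ j < suc n ] (+ g (toℕ j)) + + g (suc n)  ≡⟨ ∑-last (suc n) (λ j → + g j) ⟨
    ∑[ j < suc (suc n) ] (+ g (toℕ j))          ∎

  window : ℕ → (ℤ → ℤ) → ℤ → ℤ
  window n G c = ∑[ i < n ] G (c + + toℕ i)

  window-suc : ∀ n G c → window (suc n) G c ≡ G c + window n G (c + + 1)
  window-suc n G c = cong₂ _+_ (cong G (ℤₚ.+-identityʳ c))
    (sum-cong-≗ {n} λ i → cong G (sym (ℤₚ.+-assoc c (+ 1) (+ toℕ i))))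

  window-last : ∀ n G c → window (suc n) G c ≡ window n G c + G (c + + n)
  window-last n G c = ∑-last n (λ j → G (c + + j))

  binomialSum : ℕ → (ℕ → ℤ) → ℤ
  binomialSum i w = ∑[ j < suc i ] (+ (i C toℕ j) * w (toℕ j))

  -- The j = 0 terms of both sums compute to + 1 * w 0.
  binomialSum-suc : ∀ i w → binomialSum (suc i) w ≡ binomialSum i w + binomialSum i (w ∘ suc)
  binomialSum-suc i w = begin
    binomialSum (suc i) w
      ≡⟨ cong (_+_ (+ 1 * w 0)) (sum-cong-≗ {suc i} pascal) ⟩
    + 1 * w 0 + ∑[ j < suc i ] (f (toℕ j) + g (toℕ j))
      ≡⟨ cong (_+_ (+ 1 * w 0)) (∑-distrib-+ {suc i} (f ∘ toℕ) (g ∘ toℕ)) ⟩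
    + 1 * w 0 + (binomialSum i (w ∘ suc) + ∑[ j < suc i ] g (toℕ j))
      ≡⟨ x+[y+z]≡x+z+y (+ 1 * w 0) (binomialSum i (w ∘ suc)) (∑[ j < suc i ] g (toℕ j)) ⟩
    + 1 * w 0 + ∑[ j < suc i ] g (toℕ j) + binomialSum i (w ∘ suc)
      ≡⟨ cong (λ x → + 1 * w 0 + x + binomialSum i (w ∘ suc)) drop-last ⟩
    binomialSum i w + binomialSum i (w ∘ suc) ∎
    where
    f g : ℕ → ℤ
    f j = + (i C j) * w (suc j)
    g j = + (i C suc j) * w (suc j)
    pascal : ∀ j → + (suc i C suc (toℕ j)) * w (suc (toℕ j)) ≡ f (toℕ j) + g (toℕ j)
    pascal j = begin
      + (suc i C suc (toℕ j)) * w (suc (toℕ j))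
        ≡⟨ cong (λ c → + c * w (suc (toℕ j))) (nCk+nC[k+1]≡[n+1]C[k+1] i (toℕ j)) ⟨
      + (i C toℕ j ℕ.+ i C suc (toℕ j)) * w (suc (toℕ j))
        ≡⟨ cong (_* w (suc (toℕ j))) (ℤₚ.pos-+ (i C toℕ j) (i C suc (toℕ j))) ⟩
      (+ (i C toℕ j) + + (i C suc (toℕ j))) * w (suc (toℕ j))
        ≡⟨ ℤₚ.*-distribʳ-+ (w (suc (toℕ j))) (+ (i C toℕ j)) (+ (i C suc (toℕ j))) ⟩
      f (toℕ j) + g (toℕ j) ∎
    drop-last : ∑[ j < suc i ] g (toℕ j) ≡ ∑[ j < i ] g (toℕ j)
    drop-last = begin
      ∑[ j < suc i ] g (toℕ j)
        ≡⟨ ∑-last i g ⟩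
      ∑[ j < i ] g (toℕ j) + g i
        ≡⟨ cong (λ c → ∑[ j < i ] g (toℕ j) + + c * w (suc i)) (k>n⇒nCk≡0 (ℕₚ.n<1+n i)) ⟩
      ∑[ j < i ] g (toℕ j) + + 0
        ≡⟨ ℤₚ.+-identityʳ _ ⟩
      ∑[ j < i ] g (toℕ j) ∎
    x+[y+z]≡x+z+y : ∀ x y z → x + (y + z) ≡ x + z + y
    x+[y+z]≡x+z+y = solve-∀

  infixl 6 _⊕_ _⊝_
  infixr 7 _·_

  _⊕_ _⊝_ : (ℤ → ℤ) → (ℤ → ℤ) → ℤ → ℤ
  (a ⊕ b) n = a n + b n
  (a ⊝ b) n = a n - b n

  _·_ : ℤ → (ℤ → ℤ) → ℤ → ℤ
  (x · a) n = x * a n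

  -- The group ring ℤ[ℤ/k] as k-periodic functions ℤ → ℤ with cyclic convolution _⋆_.
  -- Taking k = suc k′ lets sums over Fin k split off the term at 0.
  module Cyclic (k′ : ℕ) where

    k : ℕ
    k = suc k′

    Periodic : (ℤ → ℤ) → Set
    Periodic G = ∀ x → G (x + + k) ≡ G x

    periodic⁻ : ∀ {G} → Periodic G → ∀ x → G (x - + k) ≡ G x
    periodic⁻ {G} per x = trans (sym (per (x - + k))) (cong G (x-y+y≡x x (+ k)))
      where x-y+y≡x : ∀ x y → x - y + y ≡ x
            x-y+y≡x = solve-∀

    ⊕-periodic : ∀ {a b} → Periodic a → Periodic b → Periodic (a ⊕ b)
    ⊕-periodic pa pb n = cong₂ _+_ (pa n) (pb n)

    ⊝-periodic : ∀ {a b} → Periodic a → Periodic b → Periodic (a ⊝ b)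
    ⊝-periodic pa pb n = cong₂ _-_ (pa n) (pb n)

    ·-periodic : ∀ x {a} → Periodic a → Periodic (x · a)
    ·-periodic x pa n = cong (x *_) (pa n)

    -- Both sides plus G c equal the window of length k + 1 at c.
    window-step : ∀ {G} → Periodic G → ∀ c → window k G (c + + 1) ≡ window k G c
    window-step {G} per c = +-cancelˡ (G c) _ _ (begin
      G c + window k G (c + + 1)  ≡⟨ window-suc k G c ⟨
      window (suc k) G c          ≡⟨ window-last k G c ⟩
      window k G c + G (c + + k)  ≡⟨ cong (_+_ (window k G c)) (per c) ⟩
      window k G c + G c          ≡⟨ ℤₚ.+-comm _ (G c) ⟩
      G c + window k G c          ∎)

    window-shift : ∀ {G} → Periodic G → ∀ c m → window k G (c + + m) ≡ window k G c
    window-shift {G} per c zero    = cong (window k G) (ℤₚ.+-identityʳ c)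
    window-shift {G} per c (suc m) = begin
      window k G (c + + suc m)    ≡⟨ cong (window k G) (ℤₚ.+-assoc c (+ 1) (+ m)) ⟨
      window k G (c + + 1 + + m)  ≡⟨ window-shift per (c + + 1) m ⟩
      window k G (c + + 1)        ≡⟨ window-step per c ⟩
      window k G c                ∎

    window-invariant : ∀ {G} → Periodic G → ∀ c → window k G c ≡ window k G (+ 0)
    window-invariant     per (+ m)    = window-shift per (+ 0) m
    window-invariant {G} per -[1+ m ] = sym (trans
      (cong (window k G) (sym (ℤₚ.+-inverseˡ (+ suc m))))
      (window-shift per -[1+ m ] (suc m)))

    infixl 7 _⋆_
    _⋆_ : (ℤ → ℤ) → (ℤ → ℤ) → ℤ → ℤ
    (a ⋆ b) n = ∑[ i < k ] (a (+ toℕ i) * b (n - + toℕ i))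

    ⋆-periodic : ∀ a {b} → Periodic b → Periodic (a ⋆ b)
    ⋆-periodic a {b} per n = sum-cong-≗ {k} λ i → cong (a (+ toℕ i) *_) (shifted (+ toℕ i))
      where
      n+k-j≡n-j+k : ∀ n k j → n + k - j ≡ n - j + k
      n+k-j≡n-j+k = solve-∀
      shifted : ∀ j → b (n + + k - j) ≡ b (n - j)
      shifted j = trans (cong b (n+k-j≡n-j+k n (+ k) j)) (per (n - j))

    ⋆-cong : ∀ {a a′ b b′} → (∀ j → a j ≡ a′ j) → (∀ j → b j ≡ b′ j) → ∀ n → (a ⋆ b) n ≡ (a′ ⋆ b′) n
    ⋆-cong a≗a′ b≗b′ n = sum-cong-≗ {k} λ i → cong₂ _*_ (a≗a′ (+ toℕ i)) (b≗b′ (n - + toℕ i))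

    toℤ-opposite : ∀ (i : Fin k) → + toℕ (opposite i) ≡ + k - + 1 - + toℕ i
    toℤ-opposite i = begin
      + toℕ (opposite i)     ≡⟨ cong +_ (Finₚ.opposite-prop i) ⟩
      + (k ℕ.∸ suc (toℕ i))  ≡⟨ pos-∸ (Finₚ.toℕ<n i) ⟩
      + k - + suc (toℕ i)    ≡⟨ k-[1+i]≡k-1-i (+ k) (+ toℕ i) ⟩
      + k - + 1 - + toℕ i    ∎
      where k-[1+i]≡k-1-i : ∀ k i → k - (+ 1 + i) ≡ k - + 1 - i
            k-[1+i]≡k-1-i = solve-∀

    -- The substitution i ↦ n - i is the reversal i ↦ k - 1 - i followed by a shift of the window.
    ⋆-comm : ∀ {a b} → Periodic a → Periodic b → ∀ n → (a ⋆ b) n ≡ (b ⋆ a) n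
    ⋆-comm {a} {b} pa pb n = begin
      (a ⋆ b) n                              ≡⟨ sum-cong-≗ {k} (λ i → swap (+ toℕ i)) ⟩
      ∑[ i < k ] G (n - + toℕ i)             ≡⟨ ∑-permute (λ i → G (n - + toℕ i)) Perm.reverse ⟩
      ∑[ i < k ] G (n - + toℕ (opposite i))  ≡⟨ sum-cong-≗ {k} (λ i → cong G (reindex i)) ⟩
      window k G (n + + 1 - + k)             ≡⟨ window-invariant pG (n + + 1 - + k) ⟩
      (b ⋆ a) n                              ∎
      where
      G : ℤ → ℤ
      G j = b j * a (n - j)
      pG : Periodic G
      pG j = cong₂ _*_ (pb j) (trans (cong a (n-[j+k]≡n-j-k n j (+ k))) (periodic⁻ pa (n - j)))
        where n-[j+k]≡n-j-k : ∀ n j k → n - (j + k) ≡ n - j - k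
              n-[j+k]≡n-j-k = solve-∀
      swap : ∀ j → a j * b (n - j) ≡ G (n - j)
      swap j = trans (ℤₚ.*-comm (a j) (b (n - j))) (cong (λ x → b (n - j) * a x) (j≡n-[n-j] n j))
        where j≡n-[n-j] : ∀ n j → j ≡ n - (n - j)
              j≡n-[n-j] = solve-∀
      reindex : ∀ (i : Fin k) → n - + toℕ (opposite i) ≡ n + + 1 - + k + + toℕ i
      reindex i = trans (cong (_-_ n) (toℤ-opposite i)) (n-[k-1-i]≡n+1-k+i n (+ k) (+ toℕ i))
        where n-[k-1-i]≡n+1-k+i : ∀ n k i → n - (k - + 1 - i) ≡ n + + 1 - k + i
              n-[k-1-i]≡n+1-k+i = solve-∀

    ⋆-distribʳ-⊕ : ∀ a b c n → ((a ⊕ b) ⋆ c) n ≡ (a ⋆ c) n + (b ⋆ c) n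
    ⋆-distribʳ-⊕ a b c n = trans
      (sum-cong-≗ {k} λ i → ℤₚ.*-distribʳ-+ (c (n - + toℕ i)) (a (+ toℕ i)) (b (+ toℕ i)))
      (∑-distrib-+ {k} (λ i → a (+ toℕ i) * c (n - + toℕ i)) (λ i → b (+ toℕ i) * c (n - + toℕ i)))

    ⋆-distribˡ-⊕ : ∀ a b c n → (a ⋆ (b ⊕ c)) n ≡ (a ⋆ b) n + (a ⋆ c) n
    ⋆-distribˡ-⊕ a b c n = trans
      (sum-cong-≗ {k} λ i → ℤₚ.*-distribˡ-+ (a (+ toℕ i)) (b (n - + toℕ i)) (c (n - + toℕ i)))
      (∑-distrib-+ {k} (λ i → a (+ toℕ i) * b (n - + toℕ i)) (λ i → a (+ toℕ i) * c (n - + toℕ i)))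

    ·-⋆ : ∀ x a b n → ((x · a) ⋆ b) n ≡ x * (a ⋆ b) n
    ·-⋆ x a b n = trans
      (sum-cong-≗ {k} λ i → ℤₚ.*-assoc x (a (+ toℕ i)) (b (n - + toℕ i)))
      (sym (*-distribˡ-sum {k} x λ i → a (+ toℕ i) * b (n - + toℕ i)))

    ⋆-· : ∀ x a b n → (a ⋆ (x · b)) n ≡ x * (a ⋆ b) n
    ⋆-· x a b n = trans
      (sum-cong-≗ {k} λ i → u*[x*v]≡x*[u*v] (a (+ toℕ i)) x (b (n - + toℕ i)))
      (sym (*-distribˡ-sum {k} x λ i → a (+ toℕ i) * b (n - + toℕ i)))
      where u*[x*v]≡x*[u*v] : ∀ u x v → u * (x * v) ≡ x * (u * v)
            u*[x*v]≡x*[u*v] = solve-∀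

    ⋆-square-expand : ∀ a b x n →
      ((a ⊕ x · b) ⋆ (a ⊕ x · b)) n ≡ (a ⋆ a) n + x * ((a ⋆ b) n + (b ⋆ a) n) + x * x * (b ⋆ b) n
    ⋆-square-expand a b x n = begin
      ((a ⊕ x · b) ⋆ (a ⊕ x · b)) n
        ≡⟨ ⋆-distribʳ-⊕ a (x · b) (a ⊕ x · b) n ⟩
      (a ⋆ (a ⊕ x · b)) n + ((x · b) ⋆ (a ⊕ x · b)) n
        ≡⟨ cong₂ _+_ (⋆-distribˡ-⊕ a a (x · b) n) (⋆-distribˡ-⊕ (x · b) a (x · b) n) ⟩
      (a ⋆ a) n + (a ⋆ (x · b)) n + (((x · b) ⋆ a) n + ((x · b) ⋆ (x · b)) n)
        ≡⟨ cong₂ _+_ (cong (_+_ ((a ⋆ a) n)) (⋆-· x a b n))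
                     (cong₂ _+_ (·-⋆ x b a n) (trans (·-⋆ x b (x · b) n) (cong (x *_) (⋆-· x b b n)))) ⟩
      (a ⋆ a) n + x * (a ⋆ b) n + (x * (b ⋆ a) n + x * (x * (b ⋆ b) n))
        ≡⟨ collect-x ((a ⋆ a) n) ((a ⋆ b) n) ((b ⋆ a) n) ((b ⋆ b) n) x ⟩
      (a ⋆ a) n + x * ((a ⋆ b) n + (b ⋆ a) n) + x * x * (b ⋆ b) n ∎
      where collect-x : ∀ p q r s x → p + x * q + (x * r + x * (x * s)) ≡ p + x * (q + r) + x * x * s
            collect-x = solve-∀

    ⋆-∣ʳ : ∀ {x} a {b} → (∀ j → x ∣ b j) → ∀ n → x ∣ (a ⋆ b) n
    ⋆-∣ʳ a {b} x∣b n = ∑-∣ {k} _ λ i → ∣n⇒∣m*n (a (+ toℕ i)) (x∣b (n - + toℕ i))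

    ⋆-∣ : ∀ {x y a b} → (∀ j → x ∣ a j) → (∀ j → y ∣ b j) → ∀ n → x * y ∣ (a ⋆ b) n
    ⋆-∣ {x} {y} {a} {b} x∣a y∣b n = ∑-∣ {k} _ λ i →
      ∣ℤ-trans (*-monoˡ-∣ y (x∣a (+ toℕ i))) (*-monoʳ-∣ (a (+ toℕ i)) (y∣b (n - + toℕ i)))

    ⋆-square-lift : ∀ {a b} m → Periodic a → Periodic b →
                    (∀ n → + 2 * m ∣ a n - b n) → ∀ n → + 4 * m ∣ (a ⋆ a) n - (b ⋆ b) n
    ⋆-square-lift {a} {b} m pa pb 2m∣a-b n = subst (+ 4 * m ∣_) (sym expand) (∣m∣n⇒∣m+n cross square)
      where
      d : ℤ → ℤ
      d = a ⊝ b
      a≗b⊕d : ∀ j → a j ≡ (b ⊕ + 1 · d) j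
      a≗b⊕d j = x≡y+1*[x-y] (a j) (b j)
        where x≡y+1*[x-y] : ∀ x y → x ≡ y + + 1 * (x - y)
              x≡y+1*[x-y] = solve-∀
      expand : (a ⋆ a) n - (b ⋆ b) n ≡ + 2 * (b ⋆ d) n + (d ⋆ d) n
      expand = begin
        (a ⋆ a) n - (b ⋆ b) n
          ≡⟨ cong (_- (b ⋆ b) n) (trans (⋆-cong a≗b⊕d a≗b⊕d n) (⋆-square-expand b d (+ 1) n)) ⟩
        (b ⋆ b) n + + 1 * ((b ⋆ d) n + (d ⋆ b) n) + + 1 * + 1 * (d ⋆ d) n - (b ⋆ b) n
          ≡⟨ cong (λ x → (b ⋆ b) n + + 1 * ((b ⋆ d) n + x) + + 1 * + 1 * (d ⋆ d) n - (b ⋆ b) n)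
                  (⋆-comm (⊝-periodic pa pb) pb n) ⟩
        (b ⋆ b) n + + 1 * ((b ⋆ d) n + (b ⋆ d) n) + + 1 * + 1 * (d ⋆ d) n - (b ⋆ b) n
          ≡⟨ cancel-b⋆b ((b ⋆ b) n) ((b ⋆ d) n) ((d ⋆ d) n) ⟩
        + 2 * (b ⋆ d) n + (d ⋆ d) n ∎
        where cancel-b⋆b : ∀ x y z → x + + 1 * (y + y) + + 1 * + 1 * z - x ≡ + 2 * y + z
              cancel-b⋆b = solve-∀
      cross : + 4 * m ∣ + 2 * (b ⋆ d) n
      cross = subst (_∣ + 2 * (b ⋆ d) n) (sym (ℤₚ.*-assoc (+ 2) (+ 2) m))
        (*-monoʳ-∣ (+ 2) (⋆-∣ʳ b 2m∣a-b n))
      square : + 4 * m ∣ (d ⋆ d) n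
      square = ∣ℤ-trans (subst (+ 4 * m ∣_) (4m*m≡2m*2m m) (∣m⇒∣m*n m (∣-refl {+ 4 * m})))
                        (⋆-∣ 2m∣a-b 2m∣a-b n)
        where 4m*m≡2m*2m : ∀ m → + 4 * m * m ≡ + 2 * m * (+ 2 * m)
              4m*m≡2m*2m = solve-∀

    multiple<k⇒≡0 : ∀ {d} → k ∣ℕ d → d ℕ.< k → d ≡ 0
    multiple<k⇒≡0 {zero}  _   _   = refl
    multiple<k⇒≡0 {suc d} k∣d d<k = contradiction k∣d (>⇒∤ d<k)

    residue-unique : ∀ {x y} → x ℕ.< k → y ℕ.< k → + k ∣ + x - + y → x ≡ y
    residue-unique {x} {y} x<k y<k k∣x-y =
      ℤₚ.+-injective (ℤₚ.i-j≡0⇒i≡j (+ x) (+ y) (ℤₚ.∣i∣≡0⇒i≡0 (multiple<k⇒≡0 (∣⇒∣ᵤ k∣x-y) ∣x-y∣<k)))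
      where
      ∣x-y∣<k : ℤ.∣ + x - + y ∣ ℕ.< k
      ∣x-y∣<k = ℕₚ.≤-<-trans
        (subst (ℕ._≤ x ℕ.⊔ y) (cong ℤ.∣_∣ (sym (ℤₚ.m-n≡m⊖n x y))) (ℤₚ.∣m⊝n∣≤m⊔n x y))
        (ℕₚ.⊔-pres-<m x<k y<k)

    ∣-%ℕ : ∀ x → + k ∣ x - + (x %ℕ k)
    ∣-%ℕ x = divides (x /ℕ k) (begin
      x - + (x %ℕ k)                            ≡⟨ cong (_- + (x %ℕ k)) (a≡a%ℕn+[a/ℕn]*n x k) ⟩
      + (x %ℕ k) + (x /ℕ k) * + k - + (x %ℕ k)  ≡⟨ r+t-r≡t (+ (x %ℕ k)) ((x /ℕ k) * + k) ⟩
      (x /ℕ k) * + k                            ∎)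
      where r+t-r≡t : ∀ r t → r + t - r ≡ t
            r+t-r≡t = solve-∀

    %ℕ-≡⇔∣ : ∀ x y → x %ℕ k ≡ y %ℕ k ⇔ + k ∣ x - y
    %ℕ-≡⇔∣ x y = mk⇔
      (λ eq → subst (+ k ∣_) (same-residue (cong +_ eq)) (∣m∣n⇒∣m-n (∣-%ℕ x) (∣-%ℕ y)))
      (λ k∣x-y → residue-unique (n%ℕd<d x k) (n%ℕd<d y k)
        (subst (+ k ∣_) (x-y-[x-r]+[y-s]≡r-s x y (+ (x %ℕ k)) (+ (y %ℕ k)))
               (∣m∣n⇒∣m+n (∣m∣n⇒∣m-n k∣x-y (∣-%ℕ x)) (∣-%ℕ y))))
      where
      x-r-[y-r]≡x-y : ∀ x y r → x - r - (y - r) ≡ x - y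
      x-r-[y-r]≡x-y = solve-∀
      x-y-[x-r]+[y-s]≡r-s : ∀ x y r s → x - y - (x - r) + (y - s) ≡ r - s
      x-y-[x-r]+[y-s]≡r-s = solve-∀
      same-residue : ∀ {r s} → r ≡ s → x - r - (y - s) ≡ x - y
      same-residue {r} refl = x-r-[y-r]≡x-y x y r

    %-≡⇔∣ : ∀ m {r} → r ℕ.< k → m ℕ.% k ≡ r ⇔ + k ∣ + m - + r
    %-≡⇔∣ m {r} r<k = mk⇔
      (λ m%k≡r → to (trans m%k≡r (sym (m<n⇒m%n≡m r<k))))
      (λ k∣m-r → trans (from k∣m-r) (m<n⇒m%n≡m r<k))
      where open Equivalence (%ℕ-≡⇔∣ (+ m) (+ r))

    periodic-multiple : ∀ {G} → Periodic G → ∀ x m → G (x + + m * + k) ≡ G x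
    periodic-multiple {G} per x zero    = cong G (ℤₚ.+-identityʳ x)
    periodic-multiple {G} per x (suc m) = begin
      G (x + + suc m * + k)    ≡⟨ cong G (x+[1+m]k≡x+mk+k x (+ m) (+ k)) ⟩
      G (x + + m * + k + + k)  ≡⟨ per (x + + m * + k) ⟩
      G (x + + m * + k)        ≡⟨ periodic-multiple per x m ⟩
      G x                      ∎
      where x+[1+m]k≡x+mk+k : ∀ x m k → x + (+ 1 + m) * k ≡ x + m * k + k
            x+[1+m]k≡x+mk+k = solve-∀

    periodic-∣ : ∀ {G} → Periodic G → ∀ {x y} → + k ∣ x - y → G x ≡ G y
    periodic-∣ {G} per {x} {y} (divides (+ m) x-y≡mk) =
      trans (cong G (m-n≡o⇒m≡n+o x-y≡mk)) (periodic-multiple per y m)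
    periodic-∣ {G} per {x} {y} (divides -[1+ m ] x-y≡-[1+m]k) = sym (begin
      G y                     ≡⟨ cong G (y≡x-[x-y] x y) ⟩
      G (x - (x - y))         ≡⟨ cong (λ z → G (x - z)) x-y≡-[1+m]k ⟩
      G (x - -[1+ m ] * + k)  ≡⟨ cong G (x-qk≡x+[-q]k x -[1+ m ] (+ k)) ⟩
      G (x + + suc m * + k)   ≡⟨ periodic-multiple per x (suc m) ⟩
      G x                     ∎)
      where y≡x-[x-y] : ∀ x y → y ≡ x - (x - y)
            y≡x-[x-y] = solve-∀
            x-qk≡x+[-q]k : ∀ x q k → x - q * k ≡ x + (- q) * k
            x-qk≡x+[-q]k = solve-∀

    residue : ℤ → Fin k
    residue n = fromℕ< (n%ℕd<d n k)

    residue-cong : ∀ {x y} → + k ∣ x - y → residue x ≡ residue y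
    residue-cong {x} {y} k∣x-y = Finₚ.fromℕ<-cong _ _ (Equivalence.from (%ℕ-≡⇔∣ x y) k∣x-y) _ _

    periodic-residue : ∀ {G} → Periodic G → ∀ n → G n ≡ G (+ toℕ (residue n))
    periodic-residue {G} per n =
      trans (periodic-∣ per (∣-%ℕ n)) (cong (G ∘ +_) (sym (Finₚ.toℕ-fromℕ< (n%ℕd<d n k))))

    periodic-∣-by-residues : ∀ {G} d → Periodic G → (∀ (r : Fin k) → d ∣ G (+ toℕ r)) → ∀ n → d ∣ G n
    periodic-∣-by-residues d per d∣G n = subst (d ∣_) (sym (periodic-residue per n)) (d∣G (residue n))

    periodic-≗-by-residues : ∀ {F G} → Periodic F → Periodic G →
                             (∀ (r : Fin k) → F (+ toℕ r) ≡ G (+ toℕ r)) → ∀ n → F n ≡ G n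
    periodic-≗-by-residues pF pG F≗G n =
      trans (periodic-residue pF n) (trans (F≗G (residue n)) (sym (periodic-residue pG n)))

    column : Mat k → ℤ → ℤ
    column M n = M (residue n) Fin.zero

    column-periodic : ∀ M → Periodic (column M)
    column-periodic M x =
      cong (λ r → M r Fin.zero) (residue-cong {x + + k} {x} (subst (+ k ∣_) (k≡x+k-x x (+ k)) ∣-refl))
      where k≡x+k-x : ∀ x k → k ≡ x + k - x
            k≡x+k-x = solve-∀

    δ : ℤ → ℤ
    δ x = indicator ⌊ + k ∣? x ⌋

    δ-periodic : Periodic δ
    δ-periodic x = cong indicator (⌊⌋-⇔
      (mk⇔ (λ k∣x+k → ∣m+n∣n⇒∣m k∣x+k ∣-refl) (λ k∣x → ∣m∣n⇒∣m+n k∣x ∣-refl)) (+ k ∣? (x + + k)) (+ k ∣? x))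

    δ-0 : δ (+ 0) ≡ + 1
    δ-0 = cong indicator (trans (isYes≗does (+ k ∣? + 0)) (dec-true (+ k ∣? + 0) (divides (+ 0) refl)))

    δ-negative : ∀ {m} → suc m ℕ.< k → δ -[1+ m ] ≡ + 0
    δ-negative {m} 1+m<k = cong indicator
      (trans (isYes≗does (+ k ∣? -[1+ m ])) (dec-false (+ k ∣? -[1+ m ]) (>⇒∤ 1+m<k ∘ ∣⇒∣ᵤ)))

    -- (1 + σ)^i for the generator σ = shift of ℤ[ℤ/k]: its value at n is Σ_{j ≡ n (mod k)} C(i, j).
    binomialClassSum : ℕ → ℤ → ℤ
    binomialClassSum i n = binomialSum i (λ j → δ (+ j - n))

    binomialClassSum-periodic : ∀ i → Periodic (binomialClassSum i)
    binomialClassSum-periodic i n = sum-cong-≗ {suc i} λ j → cong (+ (i C toℕ j) *_)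
      (trans (cong δ (j-[n+k]≡j-n-k (+ toℕ j) n (+ k))) (periodic⁻ δ-periodic (+ toℕ j - n)))
      where j-[n+k]≡j-n-k : ∀ j n k → j - (n + k) ≡ j - n - k
            j-[n+k]≡j-n-k = solve-∀

    ⋆-identityˡ : ∀ b n → (binomialClassSum 0 ⋆ b) n ≡ b n
    ⋆-identityˡ b n = begin
      (binomialClassSum 0 ⋆ b) n
        ≡⟨ cong₂ _+_ head (trans (sum-cong-≗ {k′} tail) (sum-replicate-zero k′)) ⟩
      b n + + 0
        ≡⟨ ℤₚ.+-identityʳ (b n) ⟩
      b n ∎
      where
      head : binomialClassSum 0 (+ 0) * b (n - + 0) ≡ b n
      head = begin
        (+ 1 * δ (+ 0) + + 0) * b (n - + 0)  ≡⟨ cong (λ x → (+ 1 * x + + 0) * b (n - + 0)) δ-0 ⟩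
        + 1 * b (n - + 0)                    ≡⟨ ℤₚ.*-identityˡ (b (n - + 0)) ⟩
        b (n - + 0)                          ≡⟨ cong b (ℤₚ.+-identityʳ n) ⟩
        b n                                  ∎
      tail : ∀ (i : Fin k′) → binomialClassSum 0 (+ suc (toℕ i)) * b (n - + suc (toℕ i)) ≡ + 0
      tail i = cong (λ x → (+ 1 * x + + 0) * b (n - + suc (toℕ i))) (δ-negative (Finₚ.toℕ<n (Fin.suc i)))

    shift : (ℤ → ℤ) → ℤ → ℤ
    shift a n = a (n - + 1)

    shift-⋆ : ∀ {a b} → Periodic a → Periodic b → ∀ n → (shift a ⋆ b) n ≡ (a ⋆ b) (n - + 1)
    shift-⋆ {a} {b} pa pb n = begin
      (shift a ⋆ b) n     ≡⟨ sum-cong-≗ {k} (λ i → reindex (+ toℕ i)) ⟩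
      window k H (- + 1)  ≡⟨ window-invariant pH (- + 1) ⟩
      (a ⋆ b) (n - + 1)   ∎
      where
      H : ℤ → ℤ
      H j = a j * b (n - + 1 - j)
      pH : Periodic H
      pH j = cong₂ _*_ (pa j)
        (trans (cong b (n-o-[j+k]≡n-o-j-k n (+ 1) j (+ k))) (periodic⁻ pb (n - + 1 - j)))
        where n-o-[j+k]≡n-o-j-k : ∀ n o j k → n - o - (j + k) ≡ n - o - j - k
              n-o-[j+k]≡n-o-j-k = solve-∀
      reindex : ∀ j → a (j - + 1) * b (n - j) ≡ H (- + 1 + j)
      reindex j = cong₂ _*_ (cong a (j-o≡-o+j j (+ 1))) (cong b (n-j≡n-o-[-o+j] n (+ 1) j))
        where j-o≡-o+j : ∀ j o → j - o ≡ - o + j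
              j-o≡-o+j = solve-∀
              n-j≡n-o-[-o+j] : ∀ n o j → n - j ≡ n - o - (- o + j)
              n-j≡n-o-[-o+j] = solve-∀

    binomialClassSum-suc : ∀ i n →
      binomialClassSum (suc i) n ≡ (binomialClassSum i ⊕ shift (binomialClassSum i)) n
    binomialClassSum-suc i n = trans (binomialSum-suc i (λ j → δ (+ j - n)))
      (cong (_+_ (binomialClassSum i n)) (sum-cong-≗ {suc i} λ j →
        cong (λ x → + (i C toℕ j) * δ x) (o+j-n≡j-[n-o] (+ toℕ j) n (+ 1))))
      where o+j-n≡j-[n-o] : ∀ j n o → o + j - n ≡ j - (n - o)
            o+j-n≡j-[n-o] = solve-∀

    binomialClassSum-+ : ∀ m p n →
      binomialClassSum (m ℕ.+ p) n ≡ (binomialClassSum m ⋆ binomialClassSum p) n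
    binomialClassSum-+ zero    p n = sym (⋆-identityˡ (binomialClassSum p) n)
    binomialClassSum-+ (suc m) p n = begin
      binomialClassSum (suc (m ℕ.+ p)) n
        ≡⟨ binomialClassSum-suc (m ℕ.+ p) n ⟩
      binomialClassSum (m ℕ.+ p) n + binomialClassSum (m ℕ.+ p) (n - + 1)
        ≡⟨ cong₂ _+_ (binomialClassSum-+ m p n) (binomialClassSum-+ m p (n - + 1)) ⟩
      (Bₘ ⋆ Bₚ) n + (Bₘ ⋆ Bₚ) (n - + 1)
        ≡⟨ cong (_+_ ((Bₘ ⋆ Bₚ) n)) (shift-⋆ (binomialClassSum-periodic m) (binomialClassSum-periodic p) n) ⟨
      (Bₘ ⋆ Bₚ) n + (shift Bₘ ⋆ Bₚ) n
        ≡⟨ ⋆-distribʳ-⊕ Bₘ (shift Bₘ) Bₚ n ⟨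
      ((Bₘ ⊕ shift Bₘ) ⋆ Bₚ) n
        ≡⟨ ⋆-cong {b = Bₚ} (λ j → sym (binomialClassSum-suc m j)) (λ _ → refl) n ⟩
      (binomialClassSum (suc m) ⋆ Bₚ) n ∎
      where
      Bₘ Bₚ : ℤ → ℤ
      Bₘ = binomialClassSum m
      Bₚ = binomialClassSum p

    Cmat≡binomialClassSum : ∀ i (r s : Fin k) → Cmat k i r s ≡ binomialClassSum i (+ toℕ r - + toℕ s)
    Cmat≡binomialClassSum i r s = trans (sumTo-∑ i _) (sum-cong-≗ {suc i} λ j →
      trans (pos-if _ (i C toℕ j)) (cong (λ b → + (i C toℕ j) * indicator b) (same-condition (toℕ j))))
      where
      j+s-r≡j-[r-s] : ∀ j s r → j + s - r ≡ j - (r - s)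
      j+s-r≡j-[r-s] = solve-∀
      rearrange : ∀ j → + (j ℕ.+ toℕ s) - + toℕ r ≡ + j - (+ toℕ r - + toℕ s)
      rearrange j = trans (cong (_- + toℕ r) (ℤₚ.pos-+ j (toℕ s))) (j+s-r≡j-[r-s] (+ j) (+ toℕ s) (+ toℕ r))
      same-condition : ∀ j → ⌊ (j ℕ.+ toℕ s) ℕ.% k ℕ.≟ toℕ r ⌋ ≡ ⌊ + k ∣? (+ j - (+ toℕ r - + toℕ s)) ⌋
      same-condition j =
        ⌊⌋-⇔ (mk⇔ (subst (+ k ∣_) (rearrange j) ∘ to) (from ∘ subst (+ k ∣_) (sym (rearrange j)))) _ _
        where open Equivalence (%-≡⇔∣ (j ℕ.+ toℕ s) (Finₚ.toℕ<n r))

  open Cyclic 23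

  c₀ c₁ : ℤ → ℤ
  c₀ = column C₀
  c₁ = column C₁

  c₀-periodic : Periodic c₀
  c₀-periodic = column-periodic C₀

  c₁-periodic : Periodic c₁
  c₁-periodic = column-periodic C₁

  C₀≡c₀ : ∀ r s → C₀ r s ≡ c₀ (+ toℕ r - + toℕ s)
  C₀≡c₀ = from-yes (Finₚ.all? {n = k} λ r → Finₚ.all? {n = k} λ s → C₀ r s ℤ.≟ c₀ (+ toℕ r - + toℕ s))

  C₁≡c₁ : ∀ r s → C₁ r s ≡ c₁ (+ toℕ r - + toℕ s)
  C₁≡c₁ = from-yes (Finₚ.all? {n = k} λ r → Finₚ.all? {n = k} λ s → C₁ r s ℤ.≟ c₁ (+ toℕ r - + toℕ s))

  c₀⋆c₀≡3c₀ : ∀ n → (c₀ ⋆ c₀) n ≡ + 3 * c₀ n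
  c₀⋆c₀≡3c₀ = periodic-≗-by-residues (⋆-periodic c₀ c₀-periodic) (·-periodic (+ 3) c₀-periodic)
    (from-yes (Finₚ.all? {n = k} λ r → (c₀ ⋆ c₀) (+ toℕ r) ℤ.≟ + 3 * c₀ (+ toℕ r)))

  c₀⋆c₁≡3c₁[mod4] : ∀ n → + 4 ∣ (c₀ ⋆ c₁ ⊝ + 3 · c₁) n
  c₀⋆c₁≡3c₁[mod4] = periodic-∣-by-residues (+ 4)
    (⊝-periodic (⋆-periodic c₀ c₁-periodic) (·-periodic (+ 3) c₁-periodic))
    (from-yes (Finₚ.all? {n = k} λ r → + 4 ∣? (c₀ ⋆ c₁ ⊝ + 3 · c₁) (+ toℕ r)))

  c₁⋆c₁≡0[mod2] : ∀ n → + 2 ∣ (c₁ ⋆ c₁) n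
  c₁⋆c₁≡0[mod2] = periodic-∣-by-residues (+ 2) (⋆-periodic c₁ c₁-periodic)
    (from-yes (Finₚ.all? {n = k} λ r → + 2 ∣? (c₁ ⋆ c₁) (+ toℕ r)))

  Y : ℕ → ℤ → ℤ
  Y t = c₀ ⊕ + (2 ^ (2 ℕ.+ t)) · c₁

  Y-periodic : ∀ t → Periodic (Y t)
  Y-periodic t = ⊕-periodic c₀-periodic (·-periodic (+ (2 ^ (2 ℕ.+ t))) c₁-periodic)

  Y-square : ∀ t n → + (2 ^ (5 ℕ.+ t)) ∣ (Y t ⋆ Y t ⊝ + 3 · Y (suc t)) n
  Y-square t n = divides (D + Q * F) (begin
    (Y t ⋆ Y t) n - + 3 * Y (suc t) n
      ≡⟨ cong₂ _-_ (⋆-square-expand c₀ c₁ X n) (cong (λ x → + 3 * (c₀ n + x * c₁ n)) (pos-2^-+ 3 t)) ⟩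
    (c₀ ⋆ c₀) n + X * ((c₀ ⋆ c₁) n + (c₁ ⋆ c₀) n) + X * X * (c₁ ⋆ c₁) n - + 3 * (c₀ n + + 8 * Q * c₁ n)
      ≡⟨ cong₂ (λ u v → u + X * ((c₀ ⋆ c₁) n + v) + X * X * (c₁ ⋆ c₁) n - + 3 * (c₀ n + + 8 * Q * c₁ n))
               (c₀⋆c₀≡3c₀ n) (⋆-comm c₁-periodic c₀-periodic n) ⟩
    + 3 * c₀ n + X * ((c₀ ⋆ c₁) n + (c₀ ⋆ c₁) n) + X * X * (c₁ ⋆ c₁) n - + 3 * (c₀ n + + 8 * Q * c₁ n)
      ≡⟨ cong₂ (λ u v → + 3 * c₀ n + X * (u + u) + X * X * v - + 3 * (c₀ n + + 8 * Q * c₁ n))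
               (m-n≡o⇒m≡n+o {(c₀ ⋆ c₁) n} {+ 3 * c₁ n} c₀⋆c₁-3c₁≡D*4) c₁⋆c₁≡F*2 ⟩
    + 3 * c₀ n + X * (E + E) + X * X * (F * + 2) - + 3 * (c₀ n + + 8 * Q * c₁ n)
      ≡⟨ cong (λ x → + 3 * c₀ n + x * (E + E) + x * x * (F * + 2) - + 3 * (c₀ n + + 8 * Q * c₁ n))
              (pos-2^-+ 2 t) ⟩
    + 3 * c₀ n + + 4 * Q * (E + E) + + 4 * Q * (+ 4 * Q) * (F * + 2) - + 3 * (c₀ n + + 8 * Q * c₁ n)
      ≡⟨ expand-and-collect (c₀ n) (c₁ n) D F Q ⟩
    (D + Q * F) * (+ 32 * Q)
      ≡⟨ cong (_*_ (D + Q * F)) (pos-2^-+ 5 t) ⟨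
    (D + Q * F) * + (2 ^ (5 ℕ.+ t)) ∎)
    where
    open _∣_ (c₀⋆c₁≡3c₁[mod4] n) renaming (quotient to D; equality to c₀⋆c₁-3c₁≡D*4)
    open _∣_ (c₁⋆c₁≡0[mod2] n) renaming (quotient to F; equality to c₁⋆c₁≡F*2)
    Q X E : ℤ
    Q = + (2 ^ t)
    X = + (2 ^ (2 ℕ.+ t))
    E = + 3 * c₁ n + D * + 4
    expand-and-collect : ∀ c₀ c₁ D F Q →
            + 3 * c₀ + + 4 * Q * ((+ 3 * c₁ + D * + 4) + (+ 3 * c₁ + D * + 4)) + + 4 * Q * (+ 4 * Q) * (F * + 2)
            - + 3 * (c₀ + + 8 * Q * c₁) ≡ (D + Q * F) * (+ 32 * Q)
    expand-and-collect = solve-∀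

  lift-congruence : ∀ t {A A²} → Periodic A → (∀ n → (A ⋆ A) n ≡ A² n) →
                    (∀ n → + (2 ^ (4 ℕ.+ t)) ∣ (+ 3 · A ⊝ Y t) n) →
                    ∀ n → + (2 ^ (5 ℕ.+ t)) ∣ (+ 3 · A² ⊝ Y (suc t)) n
  lift-congruence t {A} {A²} pA A⋆A≡A² 3A≡Y n =
    2^e∣3x⇒2^e∣x (5 ℕ.+ t) ((+ 3 · A² ⊝ Y (suc t)) n)
      (subst (+ (2 ^ (5 ℕ.+ t)) ∣_) telescope (∣m∣n⇒∣m+n squared (Y-square t n)))
    where
    squared : + (2 ^ (5 ℕ.+ t)) ∣ ((+ 3 · A) ⋆ (+ 3 · A)) n - (Y t ⋆ Y t) n
    squared = subst (_∣ ((+ 3 · A) ⋆ (+ 3 · A)) n - (Y t ⋆ Y t) n) (sym (pos-2^-+ 2 (3 ℕ.+ t)))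
      (⋆-square-lift (+ (2 ^ (3 ℕ.+ t))) (·-periodic (+ 3) pA) (Y-periodic t)
        (λ n → subst (_∣ (+ 3 · A) n - Y t n) (pos-2^-+ 1 (3 ℕ.+ t)) (3A≡Y n)) n)
    3x-3y≡3[x-y] : ∀ x y → + 3 * x - + 3 * y ≡ + 3 * (x - y)
    3x-3y≡3[x-y] = solve-∀
    telescope : ((+ 3 · A) ⋆ (+ 3 · A)) n - (Y t ⋆ Y t) n + (Y t ⋆ Y t ⊝ + 3 · Y (suc t)) n
              ≡ + 3 * (+ 3 · A² ⊝ Y (suc t)) n
    telescope = begin
      ((+ 3 · A) ⋆ (+ 3 · A)) n - (Y t ⋆ Y t) n + ((Y t ⋆ Y t) n - + 3 * Y (suc t) n)
        ≡⟨ ℤₚ.+-minus-telescope (((+ 3 · A) ⋆ (+ 3 · A)) n) ((Y t ⋆ Y t) n) (+ 3 * Y (suc t) n) ⟩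
      ((+ 3 · A) ⋆ (+ 3 · A)) n - + 3 * Y (suc t) n
        ≡⟨ cong (_- + 3 * Y (suc t) n) (trans (·-⋆ (+ 3) A (+ 3 · A) n) (cong (+ 3 *_) (⋆-· (+ 3) A A n))) ⟩
      + 3 * (+ 3 * (A ⋆ A) n) - + 3 * Y (suc t) n
        ≡⟨ cong (λ x → + 3 * (+ 3 * x) - + 3 * Y (suc t) n) (A⋆A≡A² n) ⟩
      + 3 * (+ 3 * A² n) - + 3 * Y (suc t) n
        ≡⟨ 3x-3y≡3[x-y] (+ 3 * A² n) (Y (suc t) n) ⟩
      + 3 * (+ 3 * A² n - Y (suc t) n) ∎

  congruence : ∀ t n → + (2 ^ (4 ℕ.+ t)) ∣ (+ 3 · binomialClassSum (3 ℕ.* 2 ^ (4 ℕ.+ t)) ⊝ Y t) n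
  congruence zero = periodic-∣-by-residues (+ 16)
    (⊝-periodic (·-periodic (+ 3) (binomialClassSum-periodic 48)) (Y-periodic 0))
    (from-yes (Finₚ.all? {n = k} λ r → + 16 ∣? (+ 3 · binomialClassSum 48 ⊝ Y 0) (+ toℕ r)))
  congruence (suc t) =
    lift-congruence t (binomialClassSum-periodic (3 ℕ.* 2 ^ (4 ℕ.+ t))) square (congruence t)
    where
    3[2x]≡3x+3x : ∀ x → 3 ℕ.* (2 ℕ.* x) ≡ 3 ℕ.* x ℕ.+ 3 ℕ.* x
    3[2x]≡3x+3x = ℕ-Solver.solve-∀
    square : ∀ n → (binomialClassSum (3 ℕ.* 2 ^ (4 ℕ.+ t)) ⋆ binomialClassSum (3 ℕ.* 2 ^ (4 ℕ.+ t))) n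
                 ≡ binomialClassSum (3 ℕ.* 2 ^ (4 ℕ.+ suc t)) n
    square n = sym (trans (cong (λ i → binomialClassSum i n) (3[2x]≡3x+3x (2 ^ (4 ℕ.+ t))))
                          (binomialClassSum-+ (3 ℕ.* 2 ^ (4 ℕ.+ t)) (3 ℕ.* 2 ^ (4 ℕ.+ t)) n))

  entrywise-congruence : ∀ t (r s : Fin 24) →
    + (2 ^ (4 ℕ.+ t)) ∣ + 3 * Cmat 24 (3 ℕ.* 2 ^ (4 ℕ.+ t)) r s - (C₀ r s + + (2 ^ (2 ℕ.+ t)) * C₁ r s)
  entrywise-congruence t r s = subst (+ (2 ^ (4 ℕ.+ t)) ∣_) (sym entries) (congruence t (+ toℕ r - + toℕ s))
    where
    entries : + 3 * Cmat 24 (3 ℕ.* 2 ^ (4 ℕ.+ t)) r s - (C₀ r s + + (2 ^ (2 ℕ.+ t)) * C₁ r s)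
            ≡ (+ 3 · binomialClassSum (3 ℕ.* 2 ^ (4 ℕ.+ t)) ⊝ Y t) (+ toℕ r - + toℕ s)
    entries = cong₂ (λ x y → + 3 * x - y) (Cmat≡binomialClassSum (3 ℕ.* 2 ^ (4 ℕ.+ t)) r s)
                    (cong₂ (λ x y → x + + (2 ^ (2 ℕ.+ t)) * y) (C₀≡c₀ r s) (C₁≡c₁ r s))

open import Defs
open import Data.Nat using (ℕ; _≤_; _∸_; _^_; _*_)
open import Data.Integer using (+_)
open import Data.Nat using (suc; s≤s)
open import Data.Integer.Divisibility.Signed using (∣⇒∣ᵤ)
open CirculantBinomials using (entrywise-congruence)

theorem8 : (u : ℕ) → 4 ≤ u →
    ((+ 3) ·ₘ Cmat 24 (3 * 2 ^ u)) ≡ₘ (C₀ +ₘ ((+ (2 ^ (u ∸ 2))) ·ₘ C₁)) [mod + (2 ^ u) ]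
theorem8 (suc (suc (suc (suc t)))) _ r s = ∣⇒∣ᵤ (entrywise-congruence t r s)
theorem8 0 ()
theorem8 1 (s≤s ())
theorem8 2 (s≤s (s≤s ()))
theorem8 3 (s≤s (s≤s (s≤s ())))
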